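{- Let $r\ge4$ be a fixed constant and let $(x_i)_{i\ge0}$ and $(y_i)_{i\ge0}$ be real sequences such that, for all $n\ge2$, \[ \sum_{i=0}^n x_i\le r\,x_{n-1}\qquad\text{and}\qquad \sum_{i=0}^n y_i=r\,y_{n-1}. \] If $x_0\ge y_0$ and $x_1\le y_1$, then $x_i\le y_i$ for all $i\ge2$. -}

module Defs where

open import Level using (Level; _⊔_) renaming (suc to lsuc)
open import Data.Nat as ℕ using (ℕ; suc)
open import Data.Product using (∃; _×_)
open import Relation.Nullary using (¬_)
open import Relation.Unary using (Pred)
open import Relation.Binary using (Rel; IsTotalOrder)
open import Algebra.Bundles using (CommutativeRing)

-- The real numbers, axiomatised as a Dedekind-complete ordered field
-- (unique up to isomorphism; agda-stdlib has no real numbers).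
record CompleteOrderedField (c ℓ₁ ℓ₂ : Level) : Set (lsuc (c ⊔ ℓ₁ ⊔ ℓ₂)) where
  field
    commutativeRing : CommutativeRing c ℓ₁
  open CommutativeRing commutativeRing public
  field
    _≤_          : Rel Carrier ℓ₂
    isTotalOrder : IsTotalOrder _≈_ _≤_
    +-mono-≤     : ∀ {x y} z → x ≤ y → (x + z) ≤ (y + z)
    *-nonneg     : ∀ {x y} → 0# ≤ x → 0# ≤ y → 0# ≤ (x * y)
    0≉1          : ¬ (0# ≈ 1#)
    inverse      : ∀ x → ¬ (x ≈ 0#) → ∃ λ y → (x * y) ≈ 1#
    sup          : (P : Pred Carrier c) → ∃ P → (∃ λ b → ∀ x → P x → x ≤ b) →
                   ∃ λ s → (∀ x → P x → x ≤ s) × (∀ b → (∀ x → P x → x ≤ b) → s ≤ b)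

  4# : Carrier
  4# = 1# + 1# + 1# + 1#

  partialSum : (ℕ → Carrier) → ℕ → Carrier
  partialSum f ℕ.zero    = f ℕ.zero
  partialSum f (suc n) = partialSum f n + f (suc n)

-- The differences δᵢ = yᵢ − xᵢ satisfy Σ_{i≤n} δᵢ ≥ r δ_{n−1} for n ≥ 2. By induction,
-- δₙ ≥ max(0, Σ_{i<n} δᵢ) for all n ≥ 1: with a = Σ_{i<n} δᵢ, d = δₙ and e = δ_{n+1},
-- the hypothesis gives a + d + e ≥ r d ≥ 4d, hence e ≥ 3d − a ≥ max(2d, a + d).
module Submission where

open import Defs
open import Data.Nat using (ℕ; zero; suc)
open import Data.Product using (_×_; _,_; proj₁)
open import Relation.Binary.Bundles using (Poset)
open import Relation.Binary.Structures using (IsTotalOrder)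
import Algebra.Properties.AbelianGroup as AbelianGroupProperties
import Algebra.Properties.CommutativeSemigroup as CommutativeSemigroupProperties
import Algebra.Properties.Ring as RingProperties
import Relation.Binary.Reasoning.PartialOrder as PartialOrderReasoning

module OrderedFieldProperties {c ℓ₁ ℓ₂} (F : CompleteOrderedField c ℓ₁ ℓ₂) where
  open CompleteOrderedField F renaming (_≤_ to infix 4 _≤_; +-mono-≤ to +-monoˡ-≤)
  open IsTotalOrder isTotalOrder using (isPartialOrder) renaming (trans to ≤-trans; reflexive to ≤-reflexive)
  open AbelianGroupProperties +-abelianGroup using (xyx⁻¹≈y; ⁻¹-∙-comm)
  open CommutativeSemigroupProperties +-commutativeSemigroup using (interchange)
  open RingProperties ring using (x[y-z]≈xy-xz)

  poset : Poset c ℓ₁ ℓ₂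
  poset = record { isPartialOrder = isPartialOrder }

  open PartialOrderReasoning poset

  +-monoʳ-≤ : ∀ z {x y} → x ≤ y → z + x ≤ z + y
  +-monoʳ-≤ z {x} {y} x≤y = begin
    z + x  ≈⟨ +-comm z x ⟩
    x + z  ≤⟨ +-monoˡ-≤ z x≤y ⟩
    y + z  ≈⟨ +-comm y z ⟩
    z + y  ∎

  +-mono-≤ : ∀ {x y u v} → x ≤ y → u ≤ v → x + u ≤ y + v
  +-mono-≤ {y = y} {u} x≤y u≤v = ≤-trans (+-monoˡ-≤ u x≤y) (+-monoʳ-≤ y u≤v)

  +-cancelˡ-≤ : ∀ z {x y} → z + x ≤ z + y → x ≤ y
  +-cancelˡ-≤ z {x} {y} z+x≤z+y = begin
    x              ≈⟨ -z+[z+w]≈w x ⟨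
    - z + (z + x)  ≤⟨ +-monoʳ-≤ (- z) z+x≤z+y ⟩
    - z + (z + y)  ≈⟨ -z+[z+w]≈w y ⟩
    y              ∎
    where
    -z+[z+w]≈w : ∀ w → - z + (z + w) ≈ w
    -z+[z+w]≈w w = trans (sym (+-assoc (- z) z w))
                         (trans (+-congʳ (-‿inverseˡ z)) (+-identityˡ w))

  x≤x+y : ∀ {x y} → 0# ≤ y → x ≤ x + y
  x≤x+y {x} {y} 0≤y = begin
    x       ≈⟨ +-identityʳ x ⟨
    x + 0#  ≤⟨ +-monoʳ-≤ x 0≤y ⟩
    x + y   ∎

  x≤y⇒0≤y-x : ∀ {x y} → x ≤ y → 0# ≤ y - x
  x≤y⇒0≤y-x {x} {y} x≤y = begin
    0#      ≈⟨ -‿inverseʳ x ⟨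
    x - x   ≤⟨ +-monoˡ-≤ (- x) x≤y ⟩
    y - x   ∎

  x≤y⇒x-y≤0 : ∀ {x y} → x ≤ y → x - y ≤ 0#
  x≤y⇒x-y≤0 {x} {y} x≤y = begin
    x - y  ≤⟨ +-monoˡ-≤ (- y) x≤y ⟩
    y - y  ≈⟨ -‿inverseʳ y ⟩
    0#     ∎

  0≤y-x⇒x≤y : ∀ {x y} → 0# ≤ y - x → x ≤ y
  0≤y-x⇒x≤y {x} {y} 0≤y-x = begin
    x              ≈⟨ +-identityˡ x ⟨
    0# + x         ≤⟨ +-monoˡ-≤ x 0≤y-x ⟩
    y - x + x      ≈⟨ +-assoc y (- x) x ⟩
    y + (- x + x)  ≈⟨ +-congˡ (-‿inverseˡ x) ⟩
    y + 0#         ≈⟨ +-identityʳ y ⟩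
    y              ∎

  neg-antimono-≤ : ∀ {x y} → x ≤ y → - y ≤ - x
  neg-antimono-≤ {x} {y} x≤y = begin
    - y            ≈⟨ +-identityˡ (- y) ⟨
    0# + - y       ≤⟨ +-monoˡ-≤ (- y) (x≤y⇒0≤y-x x≤y) ⟩
    y - x + - y    ≈⟨ xyx⁻¹≈y y (- x) ⟩
    - x            ∎

  *-monoʳ-≤-nonneg : ∀ {x y z} → 0# ≤ z → x ≤ y → x * z ≤ y * z
  *-monoʳ-≤-nonneg {x} {y} {z} 0≤z x≤y = begin
    x * z                  ≈⟨ +-identityˡ (x * z) ⟨
    0# + x * z             ≤⟨ +-monoˡ-≤ (x * z) (*-nonneg (x≤y⇒0≤y-x x≤y) 0≤z) ⟩
    (y - x) * z + x * z    ≈⟨ distribʳ z (y - x) x ⟨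
    (y - x + x) * z        ≈⟨ *-congʳ (+-assoc y (- x) x) ⟩
    (y + (- x + x)) * z    ≈⟨ *-congʳ (trans (+-congˡ (-‿inverseˡ x)) (+-identityʳ y)) ⟩
    y * z                  ∎

  4#*x≈x+x+x+x : ∀ x → 4# * x ≈ x + x + x + x
  4#*x≈x+x+x+x x =
    trans (distribʳ x _ _)
      (+-cong (trans (distribʳ x _ _)
                (+-cong (trans (distribʳ x _ _) (+-cong 1*x≈x 1*x≈x)) 1*x≈x))
              1*x≈x)
    where
    1*x≈x : 1# * x ≈ x
    1*x≈x = *-identityˡ x

  [a-b]+[c-d]≈[a+c]-[b+d] : ∀ a b c d → (a - b) + (c - d) ≈ (a + c) - (b + d)
  [a-b]+[c-d]≈[a+c]-[b+d] a b c d = trans (interchange a (- b) c (- d)) (+-congˡ (⁻¹-∙-comm b d))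

  partialSum-− : ∀ f g n → partialSum (λ i → f i - g i) n ≈ partialSum f n - partialSum g n
  partialSum-− f g zero    = refl
  partialSum-− f g (suc n) =
    trans (+-congʳ (partialSum-− f g n)) ([a-b]+[c-d]≈[a+c]-[b+d] _ _ _ _)

  Dominates : Carrier → Carrier → Set ℓ₂
  Dominates d a = 0# ≤ d × a ≤ d

  dominates-step : ∀ {r a d e} → 4# ≤ r → Dominates d a → r * d ≤ a + d + e →
                   Dominates e (a + d)
  dominates-step {r} {a} {d} {e} 4≤r (0≤d , a≤d) rd≤a+d+e = 0≤e , a+d≤e
    where
    a+d≤d+d : a + d ≤ d + d
    a+d≤d+d = +-monoˡ-≤ d a≤d

    4d≤a+d+e : d + d + (d + d) ≤ a + d + e
    4d≤a+d+e = begin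
      d + d + (d + d)  ≈⟨ +-assoc (d + d) d d ⟨
      d + d + d + d    ≈⟨ 4#*x≈x+x+x+x d ⟨
      4# * d           ≤⟨ *-monoʳ-≤-nonneg 0≤d 4≤r ⟩
      r * d            ≤⟨ rd≤a+d+e ⟩
      a + d + e        ∎

    a+d≤e : a + d ≤ e
    a+d≤e = +-cancelˡ-≤ (a + d) (begin
      a + d + (a + d)  ≤⟨ +-mono-≤ a+d≤d+d a+d≤d+d ⟩
      d + d + (d + d)  ≤⟨ 4d≤a+d+e ⟩
      a + d + e        ∎)

    0≤e : 0# ≤ e
    0≤e = +-cancelˡ-≤ (a + d) (begin
      a + d + 0#       ≈⟨ +-identityʳ (a + d) ⟩
      a + d            ≤⟨ a+d≤d+d ⟩
      d + d            ≤⟨ x≤x+y (≤-trans 0≤d (x≤x+y 0≤d)) ⟩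
      d + d + (d + d)  ≤⟨ 4d≤a+d+e ⟩
      a + d + e        ∎)

  dominates-partialSum : ∀ {r} (δ : ℕ → Carrier) → 4# ≤ r →
                         (∀ m → r * δ (suc m) ≤ partialSum δ (suc (suc m))) →
                         δ 0 ≤ 0# → 0# ≤ δ 1 →
                         ∀ n → Dominates (δ (suc n)) (partialSum δ n)
  dominates-partialSum δ 4≤r hδ δ₀≤0 0≤δ₁ zero    = 0≤δ₁ , ≤-trans δ₀≤0 0≤δ₁
  dominates-partialSum δ 4≤r hδ δ₀≤0 0≤δ₁ (suc n) =
    dominates-step 4≤r (dominates-partialSum δ 4≤r hδ δ₀≤0 0≤δ₁ n) (hδ n)

  difference-bound : ∀ {r} (x y : ℕ → Carrier) →
                     (∀ m → partialSum x (suc (suc m)) ≤ r * x (suc m)) →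
                     (∀ m → partialSum y (suc (suc m)) ≈ r * y (suc m)) →
                     ∀ m → r * (y (suc m) - x (suc m)) ≤ partialSum (λ i → y i - x i) (suc (suc m))
  difference-bound {r} x y hx hy m = begin
    r * (y (suc m) - x (suc m))          ≈⟨ x[y-z]≈xy-xz r (y (suc m)) (x (suc m)) ⟩
    r * y (suc m) - r * x (suc m)        ≤⟨ +-mono-≤ (≤-reflexive (sym (hy m))) (neg-antimono-≤ (hx m)) ⟩
    partialSum y (suc (suc m)) - partialSum x (suc (suc m))
                                         ≈⟨ partialSum-− y x (suc (suc m)) ⟨
    partialSum (λ i → y i - x i) (suc (suc m)) ∎

proposition1 : ∀ {c ℓ₁ ℓ₂} (ℝ : CompleteOrderedField c ℓ₁ ℓ₂) →
    let open CompleteOrderedField ℝ in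
    (r : Carrier) → 4# ≤ r →
    (x y : ℕ → Carrier) →
    (∀ m → partialSum x (suc (suc m)) ≤ (r * x (suc m))) →
    (∀ m → partialSum y (suc (suc m)) ≈ (r * y (suc m))) →
    y 0 ≤ x 0 → x 1 ≤ y 1 →
    ∀ m → x (suc (suc m)) ≤ y (suc (suc m))
proposition1 ℝ r 4≤r x y hx hy y₀≤x₀ x₁≤y₁ m =
  0≤y-x⇒x≤y (proj₁ (dominates-partialSum (λ i → y i - x i) 4≤r
    (difference-bound x y hx hy) (x≤y⇒x-y≤0 y₀≤x₀) (x≤y⇒0≤y-x x₁≤y₁) (suc m)))
  where
  open CompleteOrderedField ℝ using (_-_)
  open OrderedFieldProperties ℝ
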